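{- Let $G$ be a minimal counterexample with maximum degree $\Delta=6$, and let $v$ be a bad or a semi-bad $5$-vertex. If $v$ is weak-adjacent to a $5$-vertex $w$, or $v$ is star-adjacent to a $4$-vertex $w$, then $v$ is not weak-adjacent to any bad or semi-bad $5$-vertex $u$ with $u\neq w$.
   Context: All graphs are finite and simple. A 2-distance coloring of $G$ is a vertex coloring in which any two distinct vertices at distance at most $2$ receive different colors. A minimal counterexample is a planar graph $G$ with girth at least $6$ and maximum degree $\Delta=\Delta(G)\geq 6$ which admits no 2-distance coloring with $\Delta+4$ colors, and which has the minimum number of vertices among all planar graphs with girth at least $6$ and maximum degree at least $6$ admitting no 2-distance coloring with (their maximum degree)$+4$ colors. A $k$-vertex has degree $k$; a $3(1)$-vertex is a $3$-vertex adjacent to exactly one $2$-vertex. Two vertices $u,w$ are weak-adjacent if there is a path $uxw$ with $d(x)=2$. Two vertices are star-adjacent if they are the two neighbours, other than its $2$-neighbour, of some $3(1)$-vertex. A bad $5$-vertex is a $5$-vertex all of whose five neighbours are $2$-vertices, where the other neighbour of each of these $2$-vertices has degree at least $5$. A semi-bad $5$-vertex is a $5$-vertex $v$ with neighbours $u_1,\dots,u_5$ such that $u_1,\dots,u_4$ are $2$-vertices whose other neighbours have degree at least $5$, and $u_5$ is a $3(1)$-vertex whose neighbours are $v$, a $2$-vertex, and a vertex of degree $4$ or $5$ (so $v$ is star-adjacent to a $4$- or $5$-vertex). -}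

module Defs where

open import Data.Nat using (ℕ; zero; suc; _+_; _≤_; _<_; _⊔_)
open import Data.Bool using (Bool; true; false)
open import Data.Fin using (Fin; toℕ; fromℕ)
open import Data.List using (List; length; filterᵇ; map; foldr; allFin)
open import Data.Maybe using (Maybe; just)
open import Data.Product using (Σ; _×_; ∃)
open import Data.Sum using (_⊎_)
open import Data.Empty using (⊥)
open import Relation.Nullary using (¬_)
open import Relation.Binary.PropositionalEquality using (_≡_; _≢_)
open import Function.Definitions using (Injective)

record Graph (n : ℕ) : Set where
  field
    E      : Fin n → Fin n → Bool
    sym    : ∀ u v → E u v ≡ E v u
    irrefl : ∀ v → E v v ≡ false
open Graph public

module _ {n : ℕ} (G : Graph n) where

  Adj : Fin n → Fin n → Set
  Adj u v = E G u v ≡ true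

  deg : Fin n → ℕ
  deg v = length (filterᵇ (E G v) (allFin n))

  maxDeg : ℕ
  maxDeg = foldr _⊔_ 0 (map deg (allFin n))

  -- a cycle of length 3 + m
  Cycle : ℕ → Set
  Cycle m = Σ (Fin (3 + m) → Fin n) λ c →
              Injective _≡_ _≡_ c
            × (∀ i j → suc (toℕ i) ≡ toℕ j → Adj (c i) (c j))
            × Adj (c (fromℕ (2 + m))) (c Fin.zero)

  Girth≥6 : Set
  Girth≥6 = ∀ m → m < 3 → ¬ Cycle m

  data PathIn (P : Fin n → Set) : Fin n → Fin n → Set where
    here : ∀ {v} → P v → PathIn P v v
    step : ∀ {u w v} → P u → Adj u w → PathIn P w v → PathIn P u v

  -- H (given by its adjacency relation on Fin k) is a minor of G:
  -- nonempty, disjoint, connected branch sets, adjacent whenever H-adjacent.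
  HasMinor : (k : ℕ) → (Fin k → Fin k → Bool) → Set
  HasMinor k H = Σ (Fin n → Maybe (Fin k)) λ β →
      (∀ i → ∃ λ v → β v ≡ just i)
    × (∀ i u v → β u ≡ just i → β v ≡ just i → PathIn (λ x → β x ≡ just i) u v)
    × (∀ i j → H i j ≡ true → Σ (Fin n) λ u → Σ (Fin n) λ v →
          β u ≡ just i × β v ≡ just j × Adj u v)

  TwoDistColoring : ℕ → Set
  TwoDistColoring c = Σ (Fin n → Fin c) λ f →
    ∀ u v → u ≢ v → (Adj u v ⊎ (Σ (Fin n) λ x → Adj u x × Adj x v)) → f u ≢ f v

  WeakAdj : Fin n → Fin n → Set
  WeakAdj u w = u ≢ w × (Σ (Fin n) λ x → Adj u x × Adj x w × deg x ≡ 2)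

  Is31 : Fin n → Set
  Is31 y = deg y ≡ 3 × (Σ (Fin n) λ x → Adj y x × deg x ≡ 2
                         × (∀ z → Adj y z → deg z ≡ 2 → z ≡ x))

  StarAdj : Fin n → Fin n → Set
  StarAdj u w = Σ (Fin n) λ y → Is31 y × Adj y u × Adj y w × u ≢ w
                  × ¬ (deg u ≡ 2) × ¬ (deg w ≡ 2)

  Good2 : Fin n → Fin n → Set
  Good2 v x = deg x ≡ 2 × (∀ z → Adj x z → z ≢ v → 5 ≤ deg z)

  Bad5 : Fin n → Set
  Bad5 v = deg v ≡ 5 × (∀ x → Adj v x → Good2 v x)

  SemiBad5 : Fin n → Set
  SemiBad5 v = deg v ≡ 5 × (Σ (Fin n) λ u5 → Adj v u5
    × (∀ x → Adj v x → x ≢ u5 → Good2 v x)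
    × Is31 u5
    × (Σ (Fin n) λ a → Σ (Fin n) λ b → Adj u5 a × Adj u5 b × a ≢ b × b ≢ v
         × deg a ≡ 2 × (deg b ≡ 4 ⊎ deg b ≡ 5)))

K5 : Fin 5 → Fin 5 → Bool
K5 i j = Data.Bool.not (toℕ i Data.Nat.≡ᵇ toℕ j)

K33 : Fin 6 → Fin 6 → Bool
K33 i j = (toℕ i Data.Nat.<ᵇ 3) Data.Bool.xor (toℕ j Data.Nat.<ᵇ 3)

-- Planarity, stated combinatorially via Wagner's theorem.
Planar : ∀ {n} → Graph n → Set
Planar G = ¬ HasMinor G 5 K5 × ¬ HasMinor G 6 K33

Counterexample : ∀ {n} → Graph n → Set
Counterexample G = Planar G × Girth≥6 G × 6 ≤ maxDeg G
                   × ¬ TwoDistColoring G (maxDeg G + 4)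

MinimalCounterexample : ∀ {n} → Graph n → Set
MinimalCounterexample {n} G = Counterexample G
  × (∀ m (H : Graph m) → m < n → ¬ Counterexample H)

{-# OPTIONS --safe #-}
module Submission where

-- Delete the 2-vertex y joining v and u. G − y is smaller, still planar of girth ≥ 6, and keeps
-- Δ = 6 because the neighbours of y have degree 5; so it has a 2-distance coloring with 10 colors.
-- Uncolor v, u, y, the neighbour x of v on the way to w, and the 2-vertices hanging off the
-- 3-neighbours of v and u. Counting colored vertices within distance 2 through the neighbours of
-- each vertex leaves x and u at least 2 free colors and v and y at least 3. Since u ≠ w, the
-- vertices x and u are at distance ≥ 3, so x, v, y, u form a diamond K₄ − xu, which is colorable
-- from such lists; the remaining 2-vertices see at most 9 colors and are colored greedily.

open import Defs hiding (sym)
open import Data.Bool using (true)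
open import Data.Bool.Properties using (T-≡)
open import Data.Empty using (⊥)
open import Data.Fin using (Fin; zero; _≟_; punchIn; punchOut)
open import Data.Fin.Properties using (any?; punchIn-injective; punchIn-punchOut)
open import Data.List using (List; []; _∷_; [_]; _++_; length; map; filter; filterᵇ; allFin; concatMap; foldr)
open import Data.List.Properties
  using (filter-++; filter-none; length-filter; length-++; length-map; map-++; length-tabulate)
open import Data.List.Membership.Propositional using (_∈_; _∉_; lose; find)
open import Data.List.Membership.Propositional.Properties
  using (∈-∃++; ∈-allFin; ∈-filter⁺; ∈-filter⁻; ∈-concat⁺; ∈-concat⁻; ∈-map⁺; ∈-map⁻;
         ∈-++⁺ˡ; ∈-++⁺ʳ)
import Data.List.Membership.DecPropositional as DecMembership
open import Data.List.Relation.Unary.All as All using (All; []; _∷_)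
import Data.List.Relation.Unary.All.Properties as All
open import Data.List.Relation.Unary.Any using (here; there)
import Data.List.Relation.Unary.Any.Properties as Any
open import Data.List.Relation.Unary.AllPairs using ([]; _∷_)
open import Data.List.Relation.Unary.Unique.Propositional using (Unique)
import Data.List.Relation.Unary.Unique.Propositional.Properties as Unique
open import Data.List.Relation.Binary.Pointwise using (Pointwise; []; _∷_)
open import Data.List.Relation.Binary.Permutation.Propositional using (_↭_; ↭-refl; ↭-prep; ↭-trans)
open import Data.List.Relation.Binary.Permutation.Propositional.Properties
  using (shift; ∈-resp-↭; All-resp-↭; filter-↭; ↭-length) renaming (map⁺ to ↭-map⁺)
open import Data.Maybe using (Maybe; just; nothing)
open import Data.Nat using (ℕ; zero; suc; _+_; _*_; _∸_; _≤_; _<_; _⊔_; z≤n; s≤s)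
open import Data.Nat.ListAction using (sum)
open import Data.Nat.ListAction.Properties using (sum-++; sum-↭)
open import Data.Nat.Properties
  using (≤-refl; ≤-reflexive; ≤-trans; ≤-antisym; <⇒≤; <⇒≱; n≤1+n; m≤m+n; +-comm; +-assoc;
         +-mono-≤; +-monoˡ-≤; +-monoʳ-≤; *-distribʳ-+; m+n≤o⇒m≤o∸n; m≤m⊔n; m≤n⊔m; ⊔-lub; ⊔-sel)
open import Data.Product using (Σ; ∃; _,_; _×_; proj₁; proj₂)
open import Data.Sum using (_⊎_; inj₁; inj₂)
open import Data.Vec.Functional using (updateAt; insertAt)
open import Data.Vec.Functional.Properties using (updateAt-updates; updateAt-minimal; insertAt-punchIn; insertAt-lookup)
open import Function using (_∘_; const)
open import Function.Bundles using (Equivalence)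
open import Relation.Binary.Definitions using (DecidableEquality)
open import Relation.Binary.PropositionalEquality using (_≡_; _≢_; refl; sym; trans; cong; subst; ≢-sym)
open import Relation.Nullary using (¬_; yes; no; contradiction)
open import Relation.Nullary.Decidable using (¬?; T?; decidable-stable; _×-dec_)
open import Relation.Unary using (Decidable)

module _ {A : Set} where

  ∉-∷⁺ : ∀ {x a : A} {xs} → x ≢ a → x ∉ xs → x ∉ a ∷ xs
  ∉-∷⁺ x≢a x∉xs (here x≡a) = x≢a x≡a
  ∉-∷⁺ x≢a x∉xs (there x∈xs) = x∉xs x∈xs

  ∈-++-drop : ∀ {a b : A} ys zs → a ≢ b → b ∈ ys ++ [ a ] ++ zs → b ∈ ys ++ zs
  ∈-++-drop {a} ys zs a≢b b∈ with ∈-resp-↭ (shift a ys zs) b∈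
  ... | here b≡a = contradiction (sym b≡a) a≢b
  ... | there b∈ys++zs = b∈ys++zs

  ↭-split : ∀ {sp xs : List A} → Unique sp → All (_∈ xs) sp → ∃ λ rest → xs ↭ sp ++ rest
  ↭-split {[]} {xs} [] [] = xs , ↭-refl
  ↭-split {a ∷ sp} (a∉sp ∷ sp!) (a∈xs ∷ sp⊆xs)
    with ys , zs , refl ← ∈-∃++ a∈xs
    with rest , p ← ↭-split sp! (All.zipWith (λ (a≢b , b∈) → ∈-++-drop ys zs a≢b b∈) (a∉sp , sp⊆xs))
    = rest , ↭-trans (shift a ys zs) (↭-prep a p)

  length-unique-≤ : ∀ {sp xs : List A} → Unique sp → All (_∈ xs) sp → length sp ≤ length xs
  length-unique-≤ {sp} sp! sp⊆xs with rest , p ← ↭-split sp! sp⊆xs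
    rewrite ↭-length p | length-++ sp {rest} = m≤m+n (length sp) (length rest)

  length-filter-marked : ∀ {P : A → Set} (P? : Decidable P) {sp xs : List A} →
    Unique sp → All (_∈ xs) sp → All (¬_ ∘ P) sp →
    length (filter P? xs) + length sp ≤ length xs
  length-filter-marked P? {sp} sp! sp⊆xs ¬Psp with rest , p ← ↭-split sp! sp⊆xs
    rewrite ↭-length p | ↭-length (filter-↭ P? p) | filter-++ P? sp rest | filter-none P? ¬Psp
          | length-++ sp {rest} | +-comm (length (filter P? rest)) (length sp)
    = +-monoʳ-≤ (length sp) (length-filter P? rest)

  sum-≤-length* : ∀ (f : A → ℕ) {B} xs → All (λ x → f x ≤ B) xs → sum (map f xs) ≤ length xs * B
  sum-≤-length* f [] [] = z≤n
  sum-≤-length* f (x ∷ xs) (fx≤B ∷ fxs≤B) = +-mono-≤ fx≤B (sum-≤-length* f xs fxs≤B)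

  sum-map-≤ : ∀ (f : A → ℕ) {xs bs} → Pointwise (λ x b → f x ≤ b) xs bs → sum (map f xs) ≤ sum bs
  sum-map-≤ f [] = z≤n
  sum-map-≤ f (fx≤b ∷ fxs≤bs) = +-mono-≤ fx≤b (sum-map-≤ f fxs≤bs)

  sum-map-marked : ∀ (f : A → ℕ) B {sp xs : List A} → Unique sp → All (_∈ xs) sp →
    All (λ x → f x ≤ B) xs →
    sum (map f xs) + length sp * B ≤ sum (map f sp) + length xs * B
  sum-map-marked f B {sp} sp! sp⊆xs f≤B with rest , p ← ↭-split sp! sp⊆xs
    rewrite sum-↭ (↭-map⁺ f p) | map-++ f sp rest | sum-++ (map f sp) (map f rest)
          | ↭-length p | length-++ sp {rest} | *-distribʳ-+ B (length sp) (length rest)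
          | +-assoc (sum (map f sp)) (sum (map f rest)) (length sp * B)
          | +-comm (sum (map f rest)) (length sp * B)
    = +-monoʳ-≤ (sum (map f sp)) (+-monoʳ-≤ (length sp * B)
        (sum-≤-length* f rest (All.++⁻ʳ sp (All-resp-↭ p f≤B))))

∈⇒≤foldr-⊔ : ∀ {x xs} → x ∈ xs → x ≤ foldr _⊔_ 0 xs
∈⇒≤foldr-⊔ {xs = x ∷ xs} (here refl) = m≤m⊔n x (foldr _⊔_ 0 xs)
∈⇒≤foldr-⊔ {xs = x ∷ xs} (there y∈xs) = ≤-trans (∈⇒≤foldr-⊔ y∈xs) (m≤n⊔m x (foldr _⊔_ 0 xs))

foldr-⊔≤ : ∀ {d xs} → All (_≤ d) xs → foldr _⊔_ 0 xs ≤ d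
foldr-⊔≤ [] = z≤n
foldr-⊔≤ (x≤d ∷ xs≤d) = ⊔-lub x≤d (foldr-⊔≤ xs≤d)

foldr-⊔∈ : ∀ {xs} → 0 < foldr _⊔_ 0 xs → foldr _⊔_ 0 xs ∈ xs
foldr-⊔∈ {x ∷ xs} 0<max with ⊔-sel x (foldr _⊔_ 0 xs)
... | inj₁ max≡x = here max≡x
... | inj₂ max≡rest = subst (_∈ x ∷ xs) (sym max≡rest) (there (foldr-⊔∈ (subst (0 <_) max≡rest 0<max)))

module _ {A B : Set} {P : A → Set} (P? : Decidable P) (f : B → List A) where

  length-filter-concatMap : ∀ xs → length (filter P? (concatMap f xs)) ≡ sum (map (length ∘ filter P? ∘ f) xs)
  length-filter-concatMap [] = refl
  length-filter-concatMap (x ∷ xs)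
    rewrite filter-++ P? (f x) (concatMap f xs) | length-++ (filter P? (f x)) {filter P? (concatMap f xs)}
    = cong (length (filter P? (f x)) +_) (length-filter-concatMap xs)

module _ {A : Set} (_≟_ : DecidableEquality A) where
  open DecMembership _≟_ using (_∈?_)

  ∈-unique-saturated : ∀ {sp xs : List A} → Unique sp → All (_∈ xs) sp → length xs ≤ length sp →
    ∀ {x} → x ∈ xs → x ∈ sp
  ∈-unique-saturated {sp} sp! sp⊆xs |xs|≤|sp| {x} x∈xs with x ∈? sp
  ... | yes x∈sp = x∈sp
  ... | no x∉sp = contradiction |xs|≤|sp|
        (<⇒≱ (length-unique-≤ (All.¬Any⇒All¬ sp x∉sp ∷ sp!) (x∈xs ∷ sp⊆xs)))

-- Coloring the diamond from lists

module _ {k : ℕ} where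
  open DecMembership (_≟_ {k}) using (_∈?_; _∉?_)

  ∃-∉ : (F : List (Fin k)) → length F < k → ∃ λ c → c ∉ F
  ∃-∉ F |F|<k with any? (λ c → c ∉? F)
  ... | yes c∉F = c∉F
  ... | no ∄c∉F = contradiction
        (≤-trans (≤-reflexive (sym (length-tabulate (λ c → c))))
          (length-unique-≤ (Unique.allFin⁺ k)
            (All.tabulate λ {c} _ → decidable-stable (c ∈? F) (λ c∉F → ∄c∉F (c , c∉F)))))
        (<⇒≱ |F|<k)

  -- Colorings of the diamond K₄ − xu in which each vertex avoids its list F of forbidden colors.
  record DiamondColoring (Fx Fu Fv Fy : List (Fin k)) : Set where
    field
      cx cu cv cy : Fin k
      cx-ok : cx ∉ Fx
      cu-ok : cu ∉ Fu
      cv-ok : cv ∉ cx ∷ cu ∷ Fv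
      cy-ok : cy ∉ cx ∷ cu ∷ cv ∷ Fy

  module _ {Fx Fu Fv Fy : List (Fin k)} (v-room : 3 + length Fv ≤ k) (y-room : 3 + length Fy ≤ k) where

    -- When cx and cu block at most one color outside Fy, v and then y can be colored greedily.
    diamond-greedy : ∀ {cx cu} a → cx ∉ Fx → cu ∉ Fu → cx ∈ a ∷ Fy → cu ∈ a ∷ Fy →
      DiamondColoring Fx Fu Fv Fy
    diamond-greedy {cx} {cu} a cx-ok cu-ok cx∈ cu∈
      with cv , cv-ok ← ∃-∉ (cx ∷ cu ∷ Fv) v-room
      with cy , cy∉ ← ∃-∉ (a ∷ cv ∷ Fy) y-room
      = record { cx-ok = cx-ok ; cu-ok = cu-ok ; cv-ok = cv-ok ; cy-ok = cy-ok }
      where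
        widen : ∀ {c} → c ∈ a ∷ Fy → c ∈ a ∷ cv ∷ Fy
        widen (here c≡a) = here c≡a
        widen (there c∈Fy) = there (there c∈Fy)
        cy-ok : cy ∉ cx ∷ cu ∷ cv ∷ Fy
        cy-ok (here refl) = cy∉ (widen cx∈)
        cy-ok (there (here refl)) = cy∉ (widen cu∈)
        cy-ok (there (there (here refl))) = cy∉ (there (here refl))
        cy-ok (there (there (there cy∈Fy))) = cy∉ (there (there cy∈Fy))

    -- Otherwise the free colors of x and of u are disjoint and all free for y; y then takes
    -- a second free color of x, or of u if that one went to v.
    diamond-disjoint : 2 + length Fx ≤ k → 2 + length Fu ≤ k →
      (∀ {c d} → c ∉ Fx → d ∉ Fu → c ≢ d) →
      (∀ {c} → c ∉ Fx → c ∉ Fy) → (∀ {c} → c ∉ Fu → c ∉ Fy) →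
      DiamondColoring Fx Fu Fv Fy
    diamond-disjoint x-room u-room x≢u x-free u-free
      with cx₁ , cx₁∉ ← ∃-∉ Fx (<⇒≤ x-room)
      with cx₂ , cx₂∉ ← ∃-∉ (cx₁ ∷ Fx) x-room
      with cu₁ , cu₁∉ ← ∃-∉ Fu (<⇒≤ u-room)
      with cu₂ , cu₂∉ ← ∃-∉ (cu₁ ∷ Fu) u-room
      with cv , cv-ok ← ∃-∉ (cx₁ ∷ cu₁ ∷ Fv) v-room
      with cx₂ ≟ cv
    ... | no cx₂≢cv = record
      { cx-ok = cx₁∉ ; cu-ok = cu₁∉ ; cv-ok = cv-ok
      ; cy-ok = All.All¬⇒¬Any (cx₂∉ ∘ here ∷ x≢u (cx₂∉ ∘ there) cu₁∉ ∷ cx₂≢cv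
                               ∷ All.¬Any⇒All¬ Fy (x-free (cx₂∉ ∘ there)))
      }
    ... | yes refl = record
      { cx-ok = cx₁∉ ; cu-ok = cu₁∉ ; cv-ok = cv-ok
      ; cy-ok = All.All¬⇒¬Any (≢-sym (x≢u cx₁∉ (cu₂∉ ∘ there)) ∷ cu₂∉ ∘ here
                               ∷ ≢-sym (x≢u (cx₂∉ ∘ there) (cu₂∉ ∘ there))
                               ∷ All.¬Any⇒All¬ Fy (u-free (cu₂∉ ∘ there)))
      }

  diamondColoring : ∀ {Fx Fu Fv Fy : List (Fin k)} →
    2 + length Fx ≤ k → 2 + length Fu ≤ k → 3 + length Fv ≤ k → 3 + length Fy ≤ k →
    DiamondColoring Fx Fu Fv Fy
  diamondColoring {Fx} {Fu} {Fy = Fy} x-room u-room v-room y-room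
    with any? (λ c → c ∉? Fx ×-dec c ∉? Fu)
  ... | yes (c , c∉Fx , c∉Fu) = diamond-greedy v-room y-room c c∉Fx c∉Fu (here refl) (here refl)
  ... | no ∄shared with any? (λ c → c ∉? Fx ×-dec c ∈? Fy)
  ... | yes (c , c∉Fx , c∈Fy) =
    diamond-greedy v-room y-room _ c∉Fx (proj₂ (∃-∉ Fu (<⇒≤ u-room))) (there c∈Fy) (here refl)
  ... | no ∄x-blocked with any? (λ c → c ∉? Fu ×-dec c ∈? Fy)
  ... | yes (c , c∉Fu , c∈Fy) =
    diamond-greedy v-room y-room _ (proj₂ (∃-∉ Fx (<⇒≤ x-room))) c∉Fu (here refl) (there c∈Fy)
  ... | no ∄u-blocked = diamond-disjoint v-room y-room x-room u-room
    (λ c∉Fx d∉Fu c≡d → ∄shared (_ , c∉Fx , subst (_∉ Fu) (sym c≡d) d∉Fu))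
    (λ c∉Fx c∈Fy → ∄x-blocked (_ , c∉Fx , c∈Fy))
    (λ c∉Fu c∈Fy → ∄u-blocked (_ , c∉Fu , c∈Fy))

module _ {n : ℕ} (G : Graph n) where
  open DecMembership (_≟_ {n}) using (_∉?_)

  nbrs : Fin n → List (Fin n)
  nbrs z = filterᵇ (E G z) (allFin n)

  adj⇒∈nbrs : ∀ {z q} → Adj G z q → q ∈ nbrs z
  adj⇒∈nbrs {z} {q} zq = ∈-filter⁺ (T? ∘ E G z) (∈-allFin q) (Equivalence.from T-≡ zq)

  ∈nbrs⇒adj : ∀ {z q} → q ∈ nbrs z → Adj G z q
  ∈nbrs⇒adj {z} q∈ = Equivalence.to T-≡ (proj₂ (∈-filter⁻ (T? ∘ E G z) {xs = allFin n} q∈))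

  nbrs-unique : ∀ z → Unique (nbrs z)
  nbrs-unique z = Unique.filter⁺ (T? ∘ E G z) (Unique.allFin⁺ n)

  deg≤maxDeg : ∀ z → deg G z ≤ maxDeg G
  deg≤maxDeg z = ∈⇒≤foldr-⊔ (∈-map⁺ (deg G) (∈-allFin z))

  maxDeg≤ : ∀ {d} → (∀ z → deg G z ≤ d) → maxDeg G ≤ d
  maxDeg≤ deg≤d = foldr-⊔≤ (All.map⁺ {xs = allFin n} (All.tabulate (λ {z} _ → deg≤d z)))

  maxDeg-attained : ∀ {d} → maxDeg G ≡ suc d → ∃ λ z → deg G z ≡ suc d
  maxDeg-attained Δ≡1+d
    with z , _ , d≡ ← ∈-map⁻ (deg G) (subst (_∈ map (deg G) (allFin n)) Δ≡1+d
                                        (foldr-⊔∈ (subst (0 <_) (sym Δ≡1+d) (s≤s z≤n))))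
    = z , sym d≡

  adj-sym : ∀ {a b} → Adj G a b → Adj G b a
  adj-sym {a} {b} ab = trans (Graph.sym G b a) ab

  adj-saturated : ∀ {r sp z} → Unique sp → All (Adj G r) sp → deg G r ≤ length sp → Adj G r z → z ∈ sp
  adj-saturated sp! r~sp deg≤ rz = ∈-unique-saturated _≟_ sp! (All.map adj⇒∈nbrs r~sp) deg≤ (adj⇒∈nbrs rz)

  deg-≢ : ∀ {a b i j} → deg G a ≡ i → deg G b ≡ j → i ≢ j → a ≢ b
  deg-≢ deg-a deg-b i≢j refl = i≢j (trans (sym deg-a) deg-b)

  Dist≤2 : Fin n → Fin n → Set
  Dist≤2 p q = Adj G p q ⊎ Σ (Fin n) λ m → Adj G p m × Adj G m q

  Dist≤2-sym : ∀ {p q} → Dist≤2 p q → Dist≤2 q p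
  Dist≤2-sym (inj₁ pq) = inj₁ (adj-sym pq)
  Dist≤2-sym (inj₂ (m , pm , mq)) = inj₂ (m , adj-sym mq , adj-sym pm)

  others : Fin n → Fin n → List (Fin n)
  others p r = filter (λ q → ¬? (q ≟ p)) (nbrs r)

  others⁺ : ∀ {p r q} → Adj G r q → q ≢ p → q ∈ others p r
  others⁺ rq q≢p = ∈-filter⁺ (λ q → ¬? (q ≟ _)) (adj⇒∈nbrs rq) q≢p

  length-others : ∀ {p r} → Adj G r p → suc (length (others p r)) ≤ deg G r
  length-others {p} {r} rp = subst (_≤ deg G r) (+-comm (length (others p r)) 1)
    (length-filter-marked (λ q → ¬? (q ≟ p)) ([] ∷ []) (adj⇒∈nbrs rp ∷ []) ((λ p≢p → p≢p refl) ∷ []))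

  -- Every vertex at distance 1 or 2 from p, other than p, listed once per path of length ≤ 2 from p.
  ball₂ : Fin n → List (Fin n)
  ball₂ p = concatMap (λ r → r ∷ others p r) (nbrs p)

  ball₂-complete : ∀ {p q} → p ≢ q → Dist≤2 p q → q ∈ ball₂ p
  ball₂-complete p≢q (inj₁ pq) = ∈-concat⁺ (Any.map⁺ (lose (adj⇒∈nbrs pq) (here refl)))
  ball₂-complete p≢q (inj₂ (m , pm , mq)) =
    ∈-concat⁺ (Any.map⁺ (lose (adj⇒∈nbrs pm) (there (others⁺ mq (≢-sym p≢q)))))

  ball₂-sound : ∀ {p q} → q ∈ ball₂ p → Dist≤2 p q
  ball₂-sound {p} q∈ with find (Any.map⁻ (∈-concat⁻ (map (λ r → r ∷ others p r) (nbrs p)) q∈))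
  ... | r , r∈ , here refl = inj₁ (∈nbrs⇒adj r∈)
  ... | r , r∈ , there q∈others =
    inj₂ (r , ∈nbrs⇒adj r∈ , ∈nbrs⇒adj (proj₁ (∈-filter⁻ (λ q → ¬? (q ≟ p)) q∈others)))

  ballOutside : List (Fin n) → Fin n → List (Fin n)
  ballOutside U p = filter (_∉? U) (ball₂ p)

  opaque
    -- The contribution of the neighbour r of p to ballOutside U p; opaque, so that U and p
    -- can be inferred from load U p r.
    load : List (Fin n) → Fin n → Fin n → ℕ
    load U p r = length (filter (_∉? U) (r ∷ others p r))

  opaque
    unfolding load

    load≤deg∸uncolored : ∀ {U p r d us} → Adj G r p → deg G r ≡ d →
      Unique us → All (_∈ r ∷ others p r) us → All (_∈ U) us → load U p r ≤ d ∸ length us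
    load≤deg∸uncolored {U} {p} {r} rp refl us! us⊆ us∈U =
      m+n≤o⇒m≤o∸n (load U p r)
        (≤-trans (length-filter-marked (_∉? U) us! us⊆ (All.map (λ q∈U q∉U → q∉U q∈U) us∈U))
                 (length-others rp))

    length-ballOutside≤ : ∀ {U p sp bs d} B → deg G p ≡ d → Unique sp → All (Adj G p) sp →
      Pointwise (λ r b → load U p r ≤ b) sp bs → (∀ {r} → Adj G p r → load U p r ≤ B) →
      length (ballOutside U p) ≤ sum bs + d * B ∸ length sp * B
    length-ballOutside≤ {U} {p} {sp} B refl sp! p~sp sp≤bs load≤B
      rewrite length-filter-concatMap (_∉? U) (λ r → r ∷ others p r) (nbrs p)
      = m+n≤o⇒m≤o∸n _ (≤-trans
          (sum-map-marked (load U p) B sp! (All.map adj⇒∈nbrs p~sp) (All.tabulate (load≤B ∘ ∈nbrs⇒adj)))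
          (+-monoˡ-≤ (deg G p * B) (sum-map-≤ (load U p) sp≤bs)))

module _ {n k : ℕ} (G : Graph n) where
  open DecMembership (_≟_ {n}) using (_∉?_)

  ProperOutside : (Fin n → Fin k) → List (Fin n) → Set
  ProperOutside col U = ∀ {p q} → p ∉ U → q ∉ U → p ≢ q → Dist≤2 G p q → col p ≢ col q

  forbidden : (Fin n → Fin k) → List (Fin n) → Fin n → List (Fin k)
  forbidden col U p = map col (ballOutside G U p)

  length-forbidden : ∀ col U p → length (forbidden col U p) ≡ length (ballOutside G U p)
  length-forbidden col U p = length-map col (ballOutside G U p)

  ∉-forbidden : ∀ {col U p q c} → c ∉ forbidden col U p → q ∉ U → p ≢ q → Dist≤2 G p q → c ≢ col q
  ∉-forbidden {col} {U} c∉ q∉U p≢q pq refl =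
    c∉ (∈-map⁺ col (∈-filter⁺ (_∉? U) (ball₂-complete G p≢q pq) q∉U))

  properOutside-extend : ∀ {col t T c} → ProperOutside col (t ∷ T) → c ∉ forbidden col (t ∷ T) t →
    ProperOutside (updateAt col t (const c)) T
  properOutside-extend {col} {t} {c = c} proper c-ok {p} {q} p∉T q∉T p≢q pq with p ≟ t | q ≟ t
  ... | yes refl | yes refl = contradiction refl p≢q
  ... | yes refl | no q≢t rewrite updateAt-updates t {const c} col | updateAt-minimal q t {const c} col q≢t
    = ∉-forbidden c-ok (∉-∷⁺ q≢t q∉T) p≢q pq
  ... | no p≢t | yes refl rewrite updateAt-updates t {const c} col | updateAt-minimal p t {const c} col p≢t
    = ≢-sym (∉-forbidden c-ok (∉-∷⁺ p≢t p∉T) (≢-sym p≢q) (Dist≤2-sym G pq))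
  ... | no p≢t | no q≢t rewrite updateAt-minimal p t {const c} col p≢t | updateAt-minimal q t {const c} col q≢t
    = proper (∉-∷⁺ p≢t p∉T) (∉-∷⁺ q≢t q∉T) p≢q pq

  ∉-forbidden-update : ∀ {col a ca U p c} → c ∉ forbidden col (a ∷ U) p → (Dist≤2 G p a → c ≢ ca) →
    c ∉ forbidden (updateAt col a (const ca)) U p
  ∉-forbidden-update {col} {a} {ca} {U} c∉ a-ok c∈ with ∈-map⁻ (updateAt col a (const ca)) c∈
  ... | q , q∈ , refl with ∈-filter⁻ (_∉? U) {xs = ball₂ G _} q∈ | q ≟ a
  ...   | q∈ball , _ | yes refl = a-ok (ball₂-sound G q∈ball) (updateAt-updates a col)
  ...   | q∈ball , q∉U | no q≢a = c∉ (subst (_∈ forbidden col (a ∷ U) _) (sym (updateAt-minimal q a col q≢a))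
          (∈-map⁺ col (∈-filter⁺ (_∉? (a ∷ U)) q∈ball (∉-∷⁺ q≢a q∉U))))

  properOutside-colorTails : ∀ {col T} → ProperOutside col T →
    All (λ t → ∀ U → length (ballOutside G U t) < k) T → ∃ λ col′ → ProperOutside col′ []
  properOutside-colorTails {col} {[]} proper [] = col , proper
  properOutside-colorTails {col} {t ∷ T} proper (room ∷ rooms)
    with c , c-ok ← ∃-∉ (forbidden col (t ∷ T) t)
                        (subst (_< k) (sym (length-forbidden col (t ∷ T) t)) (room (t ∷ T)))
    = properOutside-colorTails (properOutside-extend proper c-ok) rooms

  properOutside[]⇒coloring : ∀ {col} → ProperOutside col [] → TwoDistColoring G k
  properOutside[]⇒coloring {col} proper = col , λ p q p≢q pq → proper (λ ()) (λ ()) p≢q pq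

  properOutside-diamond : ∀ {col x u v y T} → let U = x ∷ u ∷ v ∷ y ∷ T in
    ProperOutside col U → ¬ Dist≤2 G x u →
    2 + length (ballOutside G U x) ≤ k → 2 + length (ballOutside G U u) ≤ k →
    3 + length (ballOutside G U v) ≤ k → 3 + length (ballOutside G U y) ≤ k →
    ∃ λ col′ → ProperOutside col′ T
  properOutside-diamond {col} {x} {u} {v} {y} {T} proper x≁u x-room u-room v-room y-room =
    updateAt col₃ y (const cy) ,
    properOutside-extend (properOutside-extend (properOutside-extend (properOutside-extend proper cx-ok)
      cu-ok′) cv-ok′) cy-ok′
    where
      F : Fin n → List (Fin k)
      F = forbidden col (x ∷ u ∷ v ∷ y ∷ T)

      room : ∀ p {d} → d + length (ballOutside G (x ∷ u ∷ v ∷ y ∷ T) p) ≤ k → d + length (F p) ≤ k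
      room p {d} = subst (λ l → d + l ≤ k) (sym (length-forbidden col _ p))

      open DiamondColoring (diamondColoring {Fx = F x} {F u} {F v} {F y}
        (room x x-room) (room u u-room) (room v v-room) (room y y-room))

      col₁ = updateAt col x (const cx)
      col₂ = updateAt col₁ u (const cu)
      col₃ = updateAt col₂ v (const cv)

      cu-ok′ : cu ∉ forbidden col₁ (u ∷ v ∷ y ∷ T) u
      cu-ok′ = ∉-forbidden-update cu-ok (λ u≈x → contradiction (Dist≤2-sym G u≈x) x≁u)

      cv-ok′ : cv ∉ forbidden col₂ (v ∷ y ∷ T) v
      cv-ok′ = ∉-forbidden-update (∉-forbidden-update (cv-ok ∘ there ∘ there) (λ _ → cv-ok ∘ here))
                                  (λ _ → cv-ok ∘ there ∘ here)

      cy-ok′ : cy ∉ forbidden col₃ (y ∷ T) y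
      cy-ok′ = ∉-forbidden-update (∉-forbidden-update (∉-forbidden-update
                 (cy-ok ∘ there ∘ there ∘ there) (λ _ → cy-ok ∘ here)) (λ _ → cy-ok ∘ there ∘ here))
                 (λ _ → cy-ok ∘ there ∘ there ∘ here)

-- Deleting a vertex

deleteVertex : ∀ {m} → Graph (suc m) → Fin (suc m) → Graph m
deleteVertex G y = record
  { E = λ i j → E G (punchIn y i) (punchIn y j)
  ; sym = λ i j → Graph.sym G (punchIn y i) (punchIn y j)
  ; irrefl = λ i → irrefl G (punchIn y i)
  }

module _ {m : ℕ} (G : Graph (suc m)) (y : Fin (suc m)) where

  private
    H = deleteVertex G y

  punchIn-onto : ∀ {z} → z ≢ y → ∃ λ i → punchIn y i ≡ z
  punchIn-onto z≢y = punchOut (≢-sym z≢y) , punchIn-punchOut (≢-sym z≢y)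

  deg-deleteVertex≤ : ∀ i → deg H i ≤ deg G (punchIn y i)
  deg-deleteVertex≤ i = subst (_≤ deg G (punchIn y i)) (length-map (punchIn y) (nbrs H i))
    (length-unique-≤ (Unique.map⁺ (punchIn-injective y _ _) (nbrs-unique H i))
      (All.map⁺ (All.tabulate (adj⇒∈nbrs G ∘ ∈nbrs⇒adj H))))

  deg≤deg-deleteVertex : ∀ i → ¬ Adj G (punchIn y i) y → deg G (punchIn y i) ≤ deg H i
  deg≤deg-deleteVertex i i≁y = subst (deg G (punchIn y i) ≤_) (length-map (punchIn y) (nbrs H i))
    (length-unique-≤ (nbrs-unique G (punchIn y i)) (All.tabulate (∈H ∘ ∈nbrs⇒adj G)))
    where
      ∈H : ∀ {z} → Adj G (punchIn y i) z → z ∈ map (punchIn y) (nbrs H i)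
      ∈H {z} iz with j , refl ← punchIn-onto {z} (λ { refl → i≁y iz }) = ∈-map⁺ (punchIn y) (adj⇒∈nbrs H iz)

  maxDeg-deleteVertex : ∀ {d} → maxDeg G ≡ d → (∃ λ z → deg G z ≡ d × z ≢ y × ¬ Adj G z y) →
    maxDeg H ≡ d
  maxDeg-deleteVertex Δ≡d (z , deg-z , z≢y , z≁y) with i , refl ← punchIn-onto z≢y = ≤-antisym
    (maxDeg≤ H λ j → ≤-trans (deg-deleteVertex≤ j) (subst (deg G (punchIn y j) ≤_) Δ≡d (deg≤maxDeg G _)))
    (≤-trans (≤-reflexive (sym deg-z)) (≤-trans (deg≤deg-deleteVertex i z≁y) (deg≤maxDeg H i)))

  girth-deleteVertex : Girth≥6 G → Girth≥6 H
  girth-deleteVertex girth k k<3 (c , c-inj , c-path , c-closed) =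
    girth k k<3 (punchIn y ∘ c , c-inj ∘ punchIn-injective y _ _ , c-path , c-closed)

  minor-deleteVertex : ∀ {k K} → HasMinor H k K → HasMinor G k K
  minor-deleteVertex {k} {K} (β , onto , connected , edges) = βG , ontoG , connectedG , edgesG
    where
      βG : Fin (suc m) → Maybe (Fin k)
      βG = insertAt β y nothing

      βG-punchIn : ∀ i → βG (punchIn y i) ≡ β i
      βG-punchIn = insertAt-punchIn β y nothing

      βG-just : ∀ {z j} → βG z ≡ just j → ∃ λ i → punchIn y i ≡ z × β i ≡ just j
      βG-just {z} βz with z ≟ y
      ... | yes refl = contradiction (trans (sym (insertAt-lookup β y nothing)) βz) λ ()
      ... | no z≢y with i , refl ← punchIn-onto z≢y = i , refl , trans (sym (βG-punchIn i)) βz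

      ontoG : ∀ j → ∃ λ z → βG z ≡ just j
      ontoG j with i , βi ← onto j = punchIn y i , trans (βG-punchIn i) βi

      pathG : ∀ {j a b} → PathIn H (λ x → β x ≡ just j) a b →
              PathIn G (λ x → βG x ≡ just j) (punchIn y a) (punchIn y b)
      pathG (here βa) = here (trans (βG-punchIn _) βa)
      pathG (step βa ab path) = step (trans (βG-punchIn _) βa) ab (pathG path)

      connectedG : ∀ j a b → βG a ≡ just j → βG b ≡ just j → PathIn G (λ x → βG x ≡ just j) a b
      connectedG j a b βa βb with a′ , refl , βa′ ← βG-just βa | b′ , refl , βb′ ← βG-just βb =
        pathG (connected j a′ b′ βa′ βb′)

      edgesG : ∀ i j → K i j ≡ true →
               Σ (Fin (suc m)) λ a → Σ (Fin (suc m)) λ b → βG a ≡ just i × βG b ≡ just j × Adj G a b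
      edgesG i j Kij with a , b , βa , βb , ab ← edges i j Kij =
        punchIn y a , punchIn y b , trans (βG-punchIn a) βa , trans (βG-punchIn b) βb , ab

  planar-deleteVertex : Planar G → Planar H
  planar-deleteVertex (noK5 , noK33) = noK5 ∘ minor-deleteVertex , noK33 ∘ minor-deleteVertex

  -- y itself may get any color c: it is uncolored, and so are its neighbours, through which
  -- alone G has 2-paths that H lacks.
  insertAt-properOutside : ∀ {k U} ((φ , φ-ok) : TwoDistColoring H k) (c : Fin k) → y ∈ U →
    (∀ {z} → Adj G y z → z ∈ U) → ProperOutside G (insertAt φ y c) U
  insertAt-properOutside (φ , φ-ok) c y∈U N[y]⊆U {p} {q} p∉U q∉U p≢q pq
    with i , refl ← punchIn-onto {p} (λ { refl → p∉U y∈U })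
    with j , refl ← punchIn-onto {q} (λ { refl → q∉U y∈U })
    rewrite insertAt-punchIn φ y c i | insertAt-punchIn φ y c j
    = φ-ok i j (p≢q ∘ cong (punchIn y)) (dist-in-H pq)
    where
      dist-in-H : Dist≤2 G (punchIn y i) (punchIn y j) → Dist≤2 H i j
      dist-in-H (inj₁ ij) = inj₁ ij
      dist-in-H (inj₂ (z , iz , zj)) with z ≟ y
      ... | yes refl = contradiction (N[y]⊆U (adj-sym G iz)) p∉U
      ... | no z≢y with l , refl ← punchIn-onto z≢y = inj₂ (l , iz , zj)

-- The reducible configuration

module _ {n : ℕ} (G : Graph n) where

  -- After uncoloring x, u, v, y and the tails, each of them sees at most the stated number of
  -- colored vertices within distance 2, so 2, 2, 3, 3 and 1 of the 10 colors stay free.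
  record Configuration : Set where
    field
      x u v y : Fin n
      tails : List (Fin n)
      v~y : Adj G v y
      y~u : Adj G y u
      deg-y : deg G y ≡ 2
      deg-v : deg G v ≡ 5
      deg-u : deg G u ≡ 5
      v≢u : v ≢ u
      x≁u : ¬ Dist≤2 G x u
      x-room : length (ballOutside G (x ∷ u ∷ v ∷ y ∷ tails) x) ≤ 8
      u-room : length (ballOutside G (x ∷ u ∷ v ∷ y ∷ tails) u) ≤ 8
      v-room : length (ballOutside G (x ∷ u ∷ v ∷ y ∷ tails) v) ≤ 7
      y-room : length (ballOutside G (x ∷ u ∷ v ∷ y ∷ tails) y) ≤ 7
      tails-room : All (λ t → ∀ U → length (ballOutside G U t) ≤ 9) tails

    nbrs-y : ∀ {z} → Adj G y z → z ∈ v ∷ u ∷ []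
    nbrs-y = adj-saturated G ((v≢u ∷ []) ∷ [] ∷ []) (adj-sym G v~y ∷ y~u ∷ []) (≤-reflexive deg-y)

module _ {m : ℕ} (G : Graph (suc m)) (conf : Configuration G) where
  open Configuration conf

  configuration-extend : TwoDistColoring (deleteVertex G y) 10 → TwoDistColoring G 10
  configuration-extend φ =
    properOutside[]⇒coloring G (proj₂ (properOutside-colorTails G (proj₂ core-recolored)
                                                                  (All.map (s≤s ∘_) tails-room)))
    where
      N[y]⊆U : ∀ {z} → Adj G y z → z ∈ x ∷ u ∷ v ∷ y ∷ tails
      N[y]⊆U yz with nbrs-y yz
      ... | here refl = there (there (here refl))
      ... | there (here refl) = there (here refl)

      proper₀ : ProperOutside G (insertAt (proj₁ φ) y zero) (x ∷ u ∷ v ∷ y ∷ tails)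
      proper₀ = insertAt-properOutside G y φ zero (there (there (there (here refl)))) N[y]⊆U

      core-recolored : ∃ λ col → ProperOutside G col tails
      core-recolored = properOutside-diamond G proper₀ x≁u (s≤s (s≤s x-room)) (s≤s (s≤s u-room))
                                             (s≤s (s≤s (s≤s v-room))) (s≤s (s≤s (s≤s y-room)))

configuration-reducible : ∀ {n} (G : Graph n) → MinimalCounterexample G → maxDeg G ≡ 6 → Configuration G → ⊥
configuration-reducible {zero} G _ _ conf with () ← Configuration.x conf
configuration-reducible {suc m} G ((planar , girth , _ , uncolorable) , minimal) Δ≡6 conf =
  minimal m H ≤-refl (planar-deleteVertex G y planar , girth-deleteVertex G y girth ,
                      ≤-reflexive (sym ΔH≡6) , uncolorable ∘ extend)
  where
    open Configuration conf
    H = deleteVertex G y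

    ΔH≡6 : maxDeg H ≡ 6
    ΔH≡6 with z , deg-z ← maxDeg-attained G Δ≡6 = maxDeg-deleteVertex G y Δ≡6 (z , deg-z , z≢y , z≁y)
      where
        z≢y : z ≢ y
        z≢y refl with () ← trans (sym deg-z) deg-y
        z≁y : ¬ Adj G z y
        z≁y zy with nbrs-y (adj-sym G zy)
        ... | here refl with () ← trans (sym deg-z) deg-v
        ... | there (here refl) with () ← trans (sym deg-z) deg-u

    extend : TwoDistColoring H (maxDeg H + 4) → TwoDistColoring G (maxDeg G + 4)
    extend rewrite ΔH≡6 | Δ≡6 = configuration-extend G conf

-- Bad and semi-bad 5-vertices

module _ {n : ℕ} (G : Graph n) (Δ≤6 : ∀ z → deg G z ≤ 6) where

  load≤6 : ∀ {U p r} → Adj G p r → load G U p r ≤ 6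
  load≤6 {r = r} pr = ≤-trans (load≤deg∸uncolored G (adj-sym G pr) refl [] [] []) (Δ≤6 r)

  tail-room : ∀ {t s} → deg G t ≡ 2 → Adj G t s → deg G s ≡ 3 → ∀ U → length (ballOutside G U t) ≤ 9
  tail-room deg-t t~s deg-s _ = length-ballOutside≤ G 6 deg-t ([] ∷ []) (t~s ∷ [])
    (load≤deg∸uncolored G (adj-sym G t~s) deg-s [] [] [] ∷ []) load≤6

  heavy-≰3 : ∀ {a d} → deg G a ≡ 4 + d → ¬ deg G a ≤ 3
  heavy-≰3 deg-a deg≤3 with subst (_≤ 3) deg-a deg≤3
  ... | s≤s (s≤s (s≤s ()))

  -- What the reduction uses about a bad or semi-bad 5-vertex w; the tail of a semi-bad one is the
  -- 2-neighbour of its 3(1)-neighbour.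
  record BadLike5 (w : Fin n) : Set where
    field
      deg-w : deg G w ≡ 5
      tails : List (Fin n)
      nbr-deg≤3 : ∀ {r} → Adj G w r → deg G r ≤ 3
      nbr2-far : ∀ {r z} → Adj G w r → deg G r ≡ 2 → Adj G r z → z ≢ w → 5 ≤ deg G z
      load≤2 : ∀ {U r} → All (_∈ U) tails → Adj G w r → load G U w r ≤ 2
      tails-room : All (λ t → ∀ U → length (ballOutside G U t) ≤ 9) tails

  bad⇒BadLike5 : ∀ {w} → Bad5 G w → BadLike5 w
  bad⇒BadLike5 (deg-w , good) = record
    { deg-w = deg-w
    ; tails = []
    ; nbr-deg≤3 = λ wr → ≤-trans (≤-reflexive (proj₁ (good _ wr))) (n≤1+n 2)
    ; nbr2-far = λ wr _ → proj₂ (good _ wr) _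
    ; load≤2 = λ _ wr → load≤deg∸uncolored G (adj-sym G wr) (proj₁ (good _ wr)) [] [] []
    ; tails-room = []
    }

  semiBad⇒BadLike5 : ∀ {w} → SemiBad5 G w → BadLike5 w
  semiBad⇒BadLike5 {w} (deg-w , s , _ , good , (deg-s , _) , t , _ , s~t , _ , _ , _ , deg-t , _) = record
    { deg-w = deg-w
    ; tails = t ∷ []
    ; nbr-deg≤3 = nbr-deg≤3
    ; nbr2-far = nbr2-far
    ; load≤2 = load≤2
    ; tails-room = tail-room deg-t (adj-sym G s~t) deg-s ∷ []
    }
    where
      nbr-deg≤3 : ∀ {r} → Adj G w r → deg G r ≤ 3
      nbr-deg≤3 {r} wr with r ≟ s
      ... | yes refl = ≤-reflexive deg-s
      ... | no r≢s = ≤-trans (≤-reflexive (proj₁ (good r wr r≢s))) (n≤1+n 2)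

      nbr2-far : ∀ {r z} → Adj G w r → deg G r ≡ 2 → Adj G r z → z ≢ w → 5 ≤ deg G z
      nbr2-far {r} wr deg-r with r ≟ s
      ... | yes refl = contradiction (trans (sym deg-r) deg-s) λ ()
      ... | no r≢s = proj₂ (good r wr r≢s) _

      load≤2 : ∀ {U r} → All (_∈ U) (t ∷ []) → Adj G w r → load G U w r ≤ 2
      load≤2 {r = r} (t∈U ∷ []) wr with r ≟ s
      ... | yes refl = load≤deg∸uncolored G (adj-sym G wr) deg-s ([] ∷ [])
                         (there (others⁺ G s~t (deg-≢ G deg-t deg-w λ ())) ∷ []) (t∈U ∷ [])
      ... | no r≢s = load≤deg∸uncolored G (adj-sym G wr) (proj₁ (good r wr r≢s)) [] [] []

  badLike5 : ∀ {w} → Bad5 G w ⊎ SemiBad5 G w → BadLike5 w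
  badLike5 (inj₁ bad) = bad⇒BadLike5 bad
  badLike5 (inj₂ semiBad) = semiBad⇒BadLike5 semiBad

  -- v and u are bad or semi-bad and weak-adjacent through y; x is the neighbour of v towards w.
  module WeakPair {v u y : Fin n} (Lv : BadLike5 v) (Lu : BadLike5 u)
                  (v~y : Adj G v y) (y~u : Adj G y u) (deg-y : deg G y ≡ 2) (v≢u : v ≢ u)
                  {x : Fin n} (v~x : Adj G v x) (x≢y : x ≢ y) (x≢v : x ≢ v) where
    private
      module V = BadLike5 Lv
      module U = BadLike5 Lu

    uncolored : List (Fin n)
    uncolored = x ∷ u ∷ v ∷ y ∷ V.tails ++ U.tails

    x∈ : x ∈ uncolored
    x∈ = here refl
    u∈ : u ∈ uncolored
    u∈ = there (here refl)
    v∈ : v ∈ uncolored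
    v∈ = there (there (here refl))
    y∈ : y ∈ uncolored
    y∈ = there (there (there (here refl)))

    v-tails∈ : All (_∈ uncolored) V.tails
    v-tails∈ = All.tabulate (there ∘ there ∘ there ∘ there ∘ ∈-++⁺ˡ)
    u-tails∈ : All (_∈ uncolored) U.tails
    u-tails∈ = All.tabulate (there ∘ there ∘ there ∘ there ∘ ∈-++⁺ʳ V.tails)

    y≢v : y ≢ v
    y≢v = deg-≢ G deg-y V.deg-w λ ()

    u-room : length (ballOutside G uncolored u) ≤ 8
    u-room = length-ballOutside≤ G 2 U.deg-w ([] ∷ []) (adj-sym G y~u ∷ [])
      (load≤deg∸uncolored G y~u deg-y ((y≢v ∷ []) ∷ [] ∷ [])
         (here refl ∷ there (others⁺ G (adj-sym G v~y) v≢u) ∷ []) (y∈ ∷ v∈ ∷ []) ∷ [])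
      (U.load≤2 u-tails∈)

    v-room : load G uncolored v x ≤ 1 → length (ballOutside G uncolored v) ≤ 7
    v-room x-load = length-ballOutside≤ G 2 V.deg-w ((x≢y ∷ []) ∷ [] ∷ []) (v~x ∷ v~y ∷ [])
      (x-load ∷ load≤deg∸uncolored G (adj-sym G v~y) deg-y ((deg-≢ G deg-y U.deg-w (λ ()) ∷ []) ∷ [] ∷ [])
                  (here refl ∷ there (others⁺ G y~u (≢-sym v≢u)) ∷ []) (y∈ ∷ u∈ ∷ []) ∷ [])
      (V.load≤2 v-tails∈)

    y-room : length (ballOutside G uncolored y) ≤ 7
    y-room = length-ballOutside≤ G 6 deg-y ((v≢u ∷ []) ∷ [] ∷ []) (adj-sym G v~y ∷ y~u ∷ [])
      (load≤deg∸uncolored G v~y V.deg-w ((≢-sym x≢v ∷ []) ∷ [] ∷ [])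
         (here refl ∷ there (others⁺ G v~x x≢y) ∷ []) (v∈ ∷ x∈ ∷ []) ∷
       load≤deg∸uncolored G (adj-sym G y~u) U.deg-w ([] ∷ []) (here refl ∷ []) (u∈ ∷ []) ∷ [])
      load≤6

    configuration : load G uncolored v x ≤ 1 → length (ballOutside G uncolored x) ≤ 8 → ¬ Dist≤2 G x u →
      Configuration G
    configuration x-load x-room x≁u = record
      { v~y = v~y ; y~u = y~u ; deg-y = deg-y ; deg-v = V.deg-w ; deg-u = U.deg-w ; v≢u = v≢u ; x≁u = x≁u
      ; x-room = x-room ; u-room = u-room ; v-room = v-room x-load ; y-room = y-room
      ; tails-room = All.++⁺ V.tails-room U.tails-room
      }

  weak5-configuration : ∀ {v u y w} → BadLike5 v → BadLike5 u → Adj G v y → Adj G y u → deg G y ≡ 2 →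
    v ≢ u → u ≢ w → deg G w ≡ 5 → WeakAdj G v w → Configuration G
  weak5-configuration {v} {u} {y} {w} Lv Lu v~y y~u deg-y v≢u u≢w deg-w (v≢w , x , v~x , x~w , deg-x) =
    configuration x-load x-room x≁u
    where
      module V = BadLike5 Lv
      module U = BadLike5 Lu

      nbrs-x : ∀ {z} → Adj G x z → z ∈ v ∷ w ∷ []
      nbrs-x = adj-saturated G ((v≢w ∷ []) ∷ [] ∷ []) (adj-sym G v~x ∷ x~w ∷ []) (≤-reflexive deg-x)

      x≢y : x ≢ y
      x≢y refl with adj-saturated G ((v≢u ∷ []) ∷ [] ∷ []) (adj-sym G v~y ∷ y~u ∷ []) (≤-reflexive deg-y) x~w
      ... | here refl = v≢w refl
      ... | there (here refl) = u≢w refl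

      open WeakPair Lv Lu v~y y~u deg-y v≢u v~x x≢y (deg-≢ G deg-x V.deg-w λ ())

      x-load : load G uncolored v x ≤ 1
      x-load = load≤deg∸uncolored G (adj-sym G v~x) deg-x ([] ∷ []) (here refl ∷ []) (x∈ ∷ [])

      x-room : length (ballOutside G uncolored x) ≤ 8
      x-room = length-ballOutside≤ G 6 deg-x ((v≢w ∷ []) ∷ [] ∷ []) (adj-sym G v~x ∷ x~w ∷ [])
        (load≤deg∸uncolored G v~x V.deg-w ((≢-sym y≢v ∷ []) ∷ [] ∷ [])
           (here refl ∷ there (others⁺ G v~y (≢-sym x≢y)) ∷ []) (v∈ ∷ y∈ ∷ []) ∷
         load≤deg∸uncolored G (adj-sym G x~w) deg-w [] [] [] ∷ [])
        load≤6

      x≁u : ¬ Dist≤2 G x u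
      x≁u (inj₁ x~u) with nbrs-x x~u
      ... | here refl = v≢u refl
      ... | there (here refl) = u≢w refl
      x≁u (inj₂ (z , x~z , z~u)) with nbrs-x x~z
      ... | here refl = heavy-≰3 U.deg-w (V.nbr-deg≤3 z~u)
      ... | there (here refl) = heavy-≰3 deg-w (U.nbr-deg≤3 (adj-sym G z~u))

  star4-configuration : ∀ {v u y w} → SemiBad5 G v → BadLike5 u → Adj G v y → Adj G y u → deg G y ≡ 2 →
    v ≢ u → u ≢ w → deg G w ≡ 4 → StarAdj G v w → Configuration G
  star4-configuration {v} {u} {y} {w}
    semiBad@(deg-v , s , v~s , good , (deg-s , _) , t , _ , s~t , _ , _ , _ , deg-t , _)
    Lu v~y y~u deg-y v≢u u≢w deg-w (s′ , (deg-s′ , _) , s′~v , s′~w , v≢w , _)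
    with s′ ≟ s
  ... | no s′≢s = contradiction (trans (sym (proj₁ (good s′ (adj-sym G s′~v) s′≢s))) deg-s′) λ ()
  ... | yes refl = configuration s-load s-room s≁u
    where
      module U = BadLike5 Lu

      t≢v : t ≢ v
      t≢v = deg-≢ G deg-t deg-v λ ()
      t≢w : t ≢ w
      t≢w = deg-≢ G deg-t deg-w λ ()

      nbrs-s : ∀ {z} → Adj G s z → z ∈ v ∷ t ∷ w ∷ []
      nbrs-s = adj-saturated G ((≢-sym t≢v ∷ v≢w ∷ []) ∷ (t≢w ∷ []) ∷ [] ∷ [])
                 (adj-sym G v~s ∷ s~t ∷ s′~w ∷ []) (≤-reflexive deg-s)

      s≢y : s ≢ y
      s≢y = deg-≢ G deg-s deg-y λ ()

      open WeakPair (semiBad⇒BadLike5 semiBad) Lu v~y y~u deg-y v≢u v~s s≢y (deg-≢ G deg-s deg-v λ ())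

      t∈ : t ∈ uncolored
      t∈ = there (there (there (there (here refl))))

      s-load : load G uncolored v s ≤ 1
      s-load = load≤deg∸uncolored G (adj-sym G v~s) deg-s ((deg-≢ G deg-s deg-t (λ ()) ∷ []) ∷ [] ∷ [])
        (here refl ∷ there (others⁺ G s~t t≢v) ∷ []) (x∈ ∷ t∈ ∷ [])

      s-room : length (ballOutside G uncolored s) ≤ 8
      s-room = length-ballOutside≤ G 6 deg-s ((≢-sym t≢v ∷ v≢w ∷ []) ∷ (t≢w ∷ []) ∷ [] ∷ [])
        (adj-sym G v~s ∷ s~t ∷ s′~w ∷ [])
        (load≤deg∸uncolored G v~s deg-v ((≢-sym y≢v ∷ []) ∷ [] ∷ [])
           (here refl ∷ there (others⁺ G v~y (≢-sym s≢y)) ∷ []) (v∈ ∷ y∈ ∷ []) ∷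
         load≤deg∸uncolored G (adj-sym G s~t) deg-t ([] ∷ []) (here refl ∷ []) (t∈ ∷ []) ∷
         load≤deg∸uncolored G (adj-sym G s′~w) deg-w [] [] [] ∷ [])
        load≤6

      s≁u : ¬ Dist≤2 G s u
      s≁u (inj₁ s~u) with nbrs-s s~u
      ... | here refl = v≢u refl
      ... | there (here refl) = deg-≢ G deg-t U.deg-w (λ ()) refl
      ... | there (there (here refl)) = u≢w refl
      s≁u (inj₂ (z , s~z , z~u)) with nbrs-s s~z
      ... | here refl = heavy-≰3 deg-v (U.nbr-deg≤3 (adj-sym G z~u))
      ... | there (here refl) = <⇒≱ (U.nbr2-far (adj-sym G z~u) deg-t (adj-sym G s~t) (deg-≢ G deg-s U.deg-w λ ()))
                                    (≤-trans (≤-reflexive deg-s) (n≤1+n 3))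
      ... | there (there (here refl)) = heavy-≰3 deg-w (U.nbr-deg≤3 (adj-sym G z~u))

lemma2p14 : ∀ {n} (G : Graph n) → MinimalCounterexample G → maxDeg G ≡ 6 →
    ∀ v → (Bad5 G v ⊎ SemiBad5 G v) →
    ∀ w → ((deg G w ≡ 5 × WeakAdj G v w) ⊎ (deg G w ≡ 4 × StarAdj G v w)) →
    ∀ u → (Bad5 G u ⊎ SemiBad5 G u) → u ≢ w → ¬ WeakAdj G v u
lemma2p14 G minimal Δ≡6 v v-bad w v-w u u-bad u≢w (v≢u , y , v~y , y~u , deg-y) =
  configuration-reducible G minimal Δ≡6 (configuration v-bad v-w)
  where
    Δ≤6 : ∀ z → deg G z ≤ 6
    Δ≤6 z = subst (deg G z ≤_) Δ≡6 (deg≤maxDeg G z)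

    configuration : Bad5 G v ⊎ SemiBad5 G v →
      (deg G w ≡ 5 × WeakAdj G v w) ⊎ (deg G w ≡ 4 × StarAdj G v w) → Configuration G
    configuration v-bad (inj₁ (deg-w , weak)) =
      weak5-configuration G Δ≤6 (badLike5 G Δ≤6 v-bad) (badLike5 G Δ≤6 u-bad) v~y y~u deg-y v≢u u≢w deg-w weak
    configuration (inj₁ (_ , good)) (inj₂ (_ , s , (deg-s , _) , s~v , _)) =
      contradiction (trans (sym (proj₁ (good s (adj-sym G s~v)))) deg-s) λ ()
    configuration (inj₂ semiBad) (inj₂ (deg-w , star)) =
      star4-configuration G Δ≤6 semiBad (badLike5 G Δ≤6 u-bad) v~y y~u deg-y v≢u u≢w deg-w star
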